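{- For all $n\geq3$, the order of $G_n$ is $2^{n+2}$.
   Context: Let $T$ be the infinite regular rooted binary tree (vertices: finite words over $\{1,2\}$), $T_n$ the subtree of words of length at most $n$, $\Omega=\mathrm{Aut}(T)$, and $\pi_n:\Omega\to\mathrm{Aut}(T_n)$ restriction. Write elements of $\Omega$ as $(u,v)\tau$ with $u,v\in\Omega$ (actions on the two subtrees at level 1) and $\tau\in\{\mathrm{id},\sigma\}$, $\sigma=(\mathrm{id},\mathrm{id})\sigma$ the swap; multiplication: $(x_1,x_2)\tau(y_1,y_2)\tau'=(x_1y_{\tau(1)},x_2y_{\tau(2)})\tau\tau'$. Let $a_1,a_2,a_3\in\Omega$ be the unique elements with $a_1=\sigma$, $a_2=(a_3^{ -1},a_2^{ -1})\sigma$, $a_3=(a_2,a_3)$, let $G$ be the closed subgroup of $\Omega$ topologically generated by $a_1,a_2,a_3$, and $G_n=\pi_n(G)$. -}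

module Defs where

open import Data.Nat using (ℕ; zero; suc)
open import Data.Bool using (Bool; true; false; _xor_)
open import Data.Unit using (⊤; tt)
open import Data.Product using (_×_; _,_)
open import Data.Fin using (Fin)
open import Data.Fin.Patterns using (0F; 1F; 2F)

-- Aut n = Aut(T_n), the automorphism group of the binary rooted tree of depth n.
-- An element of Aut(T_(n+1)) is written (u , v , τ) = (u,v)τ with u v ∈ Aut(T_n)
-- and τ ∈ Bool (false = id, true = σ the swap).
Aut : ℕ → Set
Aut zero    = ⊤
Aut (suc n) = Aut n × Aut n × Bool

e : (n : ℕ) → Aut n
e zero    = tt
e (suc n) = e n , e n , false

-- multiplication: (x1,x2)τ (y1,y2)τ' = (x1 y_τ(1), x2 y_τ(2)) ττ'
mul : (n : ℕ) → Aut n → Aut n → Aut n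
mul zero    _ _ = tt
mul (suc n) (x₁ , x₂ , false) (y₁ , y₂ , τ') = mul n x₁ y₁ , mul n x₂ y₂ , τ'
mul (suc n) (x₁ , x₂ , true)  (y₁ , y₂ , τ') = mul n x₁ y₂ , mul n x₂ y₁ , true xor τ'

inv : (n : ℕ) → Aut n → Aut n
inv zero    _ = tt
inv (suc n) (x₁ , x₂ , false) = inv n x₁ , inv n x₂ , false
inv (suc n) (x₁ , x₂ , true)  = inv n x₂ , inv n x₁ , true

-- π_n(a₁), π_n(a₂), π_n(a₃): restrictions of a₁ = σ, a₂ = (a₃⁻¹, a₂⁻¹)σ, a₃ = (a₂, a₃)
-- to T_n (restriction of (u,v)τ to T_(n+1) is (π_n u, π_n v)τ).
a₁ : (n : ℕ) → Aut n
a₁ zero    = tt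
a₁ (suc n) = e n , e n , true

a₂ : (n : ℕ) → Aut n
a₃ : (n : ℕ) → Aut n
a₂ zero    = tt
a₂ (suc n) = inv n (a₃ n) , inv n (a₂ n) , true
a₃ zero    = tt
a₃ (suc n) = a₂ n , a₃ n , false

gen : (n : ℕ) → Fin 3 → Aut n
gen n 0F = a₁ n
gen n 1F = a₂ n
gen n 2F = a₃ n

-- G_n : the subgroup of Aut(T_n) generated by π_n(a₁), π_n(a₂), π_n(a₃)
-- (this equals π_n(G), G the closure of ⟨a₁,a₂,a₃⟩, since π_n is continuous
-- with discrete finite target).
data InG (n : ℕ) : Aut n → Set where
  g-gen : (i : Fin 3) → InG n (gen n i)
  g-e   : InG n (e n)
  g-mul : {x y : Aut n} → InG n x → InG n y → InG n (mul n x y)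
  g-inv : {x : Aut n} → InG n x → InG n (inv n x)

-- Read a vertex word c₁c₂…cₙ of T as the residue c₁ + π(−1)^c₁ (c₂ + π(−1)^c₂ (… cₙ …)) modulo πⁿ,
-- where π = −1 − i is the prime of ℤ[i] above 2. For every odd u and every d, the map z ↦ u z + d
-- then acts on Tₙ as an automorphism (affine n u d), and composing such maps is multiplication in
-- Aut(Tₙ). In these coordinates a₁ = (z ↦ −z + 1), a₂ = (z ↦ iz − 1) and a₃ = (z ↦ iz + 1 + i), so
-- every element of Gₙ is z ↦ u z + d with u ∈ {±1, ±i}. Conversely Gₙ contains the translation by
-- 2 + i = 1 − π (namely a₂⁻¹a₃) and is closed under the conjugation by a₂, which multiplies
-- translations by i; hence it contains the translation by (1 − π)(1 + π + … + π^(n−1)) ≡ 1, then by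
-- every residue, and so all 4 · 2ⁿ affine maps with unit multiplier. These are pairwise distinct as
-- soon as ±1, ±i are distinct modulo πⁿ, which is the case exactly when n ≥ 3.

module Submission where

open import Defs

module IntegerHalving where

  open import Data.Bool using (Bool; true; false; not)
  open import Data.Integer as ℤ using (ℤ; +_; -[1+_])
  open import Data.Nat as ℕ using (ℕ; zero; suc)
  open import Data.Nat.Properties using (+-suc)
  open import Data.Product as Product using (_×_; _,_; proj₁; proj₂)
  open import Function using (_∘′_)
  open import Relation.Binary.PropositionalEquality

  bitℕ : Bool → ℕ
  bitℕ false = 0
  bitℕ true  = 1

  bit : Bool → ℤ
  bit c = + bitℕ c

  halfℕ : ℕ → Bool × ℕ
  halfℕ zero          = false , zero
  halfℕ (suc zero)    = true , zero
  halfℕ (suc (suc n)) = Product.map₂ suc (halfℕ n)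

  halve : ℤ → Bool × ℤ
  halve (+ n)    = Product.map₂ +_ (halfℕ n)
  halve -[1+ n ] = Product.map not -[1+_] (halfℕ n)

  private
    bitℕ+double-suc : ∀ c h → bitℕ c ℕ.+ (suc h ℕ.+ suc h) ≡ suc (suc (bitℕ c ℕ.+ (h ℕ.+ h)))
    bitℕ+double-suc false h = cong suc (+-suc h h)
    bitℕ+double-suc true  h = cong (suc ∘′ suc) (+-suc h h)

  halfℕ-correct : ∀ n → n ≡ bitℕ (proj₁ (halfℕ n)) ℕ.+ (proj₂ (halfℕ n) ℕ.+ proj₂ (halfℕ n))
  halfℕ-correct zero          = refl
  halfℕ-correct (suc zero)    = refl
  halfℕ-correct (suc (suc n)) =
    trans (cong (suc ∘′ suc) (halfℕ-correct n)) (sym (bitℕ+double-suc (proj₁ (halfℕ n)) (proj₂ (halfℕ n))))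

  halfℕ-bit+double : ∀ c h → halfℕ (bitℕ c ℕ.+ (h ℕ.+ h)) ≡ (c , h)
  halfℕ-bit+double false zero    = refl
  halfℕ-bit+double true  zero    = refl
  halfℕ-bit+double c     (suc h) rewrite bitℕ+double-suc c h = cong (Product.map₂ suc) (halfℕ-bit+double c h)

  halve-correct : ∀ a → a ≡ bit (proj₁ (halve a)) ℤ.+ (proj₂ (halve a) ℤ.+ proj₂ (halve a))
  halve-correct (+ n)    = cong +_ (halfℕ-correct n)
  halve-correct -[1+ n ] with halfℕ n | halfℕ-correct n
  ... | false , h | refl = refl
  ... | true  , h | refl = refl

  halve-bit+double : ∀ c h → halve (bit c ℤ.+ (h ℤ.+ h)) ≡ (c , h)
  halve-bit+double c     (+ m)    = cong (Product.map₂ +_) (halfℕ-bit+double c m)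
  halve-bit+double false -[1+ m ] = cong (Product.map not -[1+_]) (halfℕ-bit+double true m)
  halve-bit+double true  -[1+ m ] = cong (Product.map not -[1+_]) (halfℕ-bit+double false m)

module GaussianIntegers where

  open import Algebra.Bundles using (CommutativeRing)
  open import Algebra.Structures using (IsCommutativeRing)
  open import Data.Integer as ℤ using (ℤ; +_; -[1+_])
  open import Data.Integer.Properties as ℤ using ()
  open import Data.Integer.Solver using (module +-*-Solver)
  open import Data.Product using (_,_)
  open import Relation.Binary.Definitions using (DecidableEquality)
  open import Relation.Binary.PropositionalEquality
  open import Relation.Nullary.Decidable using (map′; _×-dec_; dec⇒maybe)
  open import Tactic.RingSolver.Core.AlmostCommutativeRing using (AlmostCommutativeRing; fromCommutativeRing)
  open +-*-Solver

  infix 5 _,,_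
  data ℤ[i] : Set where
    _,,_ : ℤ → ℤ → ℤ[i]

  open import Algebra.Definitions {A = ℤ[i]} _≡_
    using (Associative; Commutative; LeftIdentity; LeftInverse; _DistributesOverˡ_)
  open import Algebra.Consequences.Propositional {A = ℤ[i]}
    using (comm∧idˡ⇒id; comm∧invˡ⇒inv; comm∧distrˡ⇒distrʳ)

  infixl 6 _+_
  infixl 7 _*_
  infix  8 -_
  infix  4 _≟_

  _+_ : ℤ[i] → ℤ[i] → ℤ[i]
  (a ,, b) + (c ,, d) = a ℤ.+ c ,, b ℤ.+ d

  _*_ : ℤ[i] → ℤ[i] → ℤ[i]
  (a ,, b) * (c ,, d) = a ℤ.* c ℤ.- b ℤ.* d ,, a ℤ.* d ℤ.+ b ℤ.* c

  -_ : ℤ[i] → ℤ[i]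
  - (a ,, b) = ℤ.- a ,, ℤ.- b

  0# 1# i π : ℤ[i]
  0# = + 0 ,, + 0
  1# = + 1 ,, + 0
  i  = + 0 ,, + 1
  π  = -[1+ 0 ] ,, -[1+ 0 ]

  _≟_ : DecidableEquality ℤ[i]
  (a ,, b) ≟ (c ,, d) =
    map′ (λ (a≡c , b≡d) → cong₂ _,,_ a≡c b≡d) (λ { refl → refl , refl }) ((a ℤ.≟ c) ×-dec (b ℤ.≟ d))

  +-assoc : Associative _+_
  +-assoc (a ,, b) (c ,, d) (e ,, f) = cong₂ _,,_ (ℤ.+-assoc a c e) (ℤ.+-assoc b d f)

  +-comm : Commutative _+_
  +-comm (a ,, b) (c ,, d) = cong₂ _,,_ (ℤ.+-comm a c) (ℤ.+-comm b d)

  +-identityˡ : LeftIdentity 0# _+_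
  +-identityˡ (a ,, b) = cong₂ _,,_ (ℤ.+-identityˡ a) (ℤ.+-identityˡ b)

  +-inverseˡ : LeftInverse 0# -_ _+_
  +-inverseˡ (a ,, b) = cong₂ _,,_ (ℤ.+-inverseˡ a) (ℤ.+-inverseˡ b)

  *-assoc : Associative _*_
  *-assoc (a ,, b) (c ,, d) (e ,, f) = cong₂ _,,_
    (solve 6 (λ a b c d e f → (a :* c :- b :* d) :* e :- (a :* d :+ b :* c) :* f
                           := a :* (c :* e :- d :* f) :- b :* (c :* f :+ d :* e)) refl a b c d e f)
    (solve 6 (λ a b c d e f → (a :* c :- b :* d) :* f :+ (a :* d :+ b :* c) :* e
                           := a :* (c :* f :+ d :* e) :+ b :* (c :* e :- d :* f)) refl a b c d e f)

  *-comm : Commutative _*_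
  *-comm (a ,, b) (c ,, d) = cong₂ _,,_
    (solve 4 (λ a b c d → a :* c :- b :* d := c :* a :- d :* b) refl a b c d)
    (solve 4 (λ a b c d → a :* d :+ b :* c := c :* b :+ d :* a) refl a b c d)

  *-identityˡ : LeftIdentity 1# _*_
  *-identityˡ (a ,, b) = cong₂ _,,_
    (solve 2 (λ a b → con (+ 1) :* a :- con (+ 0) :* b := a) refl a b)
    (solve 2 (λ a b → con (+ 1) :* b :+ con (+ 0) :* a := b) refl a b)

  *-distribˡ-+ : _*_ DistributesOverˡ _+_
  *-distribˡ-+ (a ,, b) (c ,, d) (e ,, f) = cong₂ _,,_
    (solve 6 (λ a b c d e f → a :* (c :+ e) :- b :* (d :+ f) := (a :* c :- b :* d) :+ (a :* e :- b :* f)) refl a b c d e f)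
    (solve 6 (λ a b c d e f → a :* (d :+ f) :+ b :* (c :+ e) := (a :* d :+ b :* c) :+ (a :* f :+ b :* e)) refl a b c d e f)

  +-*-isCommutativeRing : IsCommutativeRing _≡_ _+_ _*_ -_ 0# 1#
  +-*-isCommutativeRing = record
    { isRing = record
      { +-isAbelianGroup = record
        { isGroup = record
          { isMonoid = record
            { isSemigroup = record
              { isMagma = record { isEquivalence = isEquivalence ; ∙-cong = cong₂ _+_ }
              ; assoc   = +-assoc
              }
            ; identity = comm∧idˡ⇒id +-comm +-identityˡ
            }
          ; inverse = comm∧invˡ⇒inv +-comm +-inverseˡ
          ; ⁻¹-cong = cong -_
          }
        ; comm = +-comm
        }
      ; *-cong     = cong₂ _*_
      ; *-assoc    = *-assoc
      ; *-identity = comm∧idˡ⇒id *-comm *-identityˡ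
      ; distrib    = *-distribˡ-+ , comm∧distrˡ⇒distrʳ *-comm *-distribˡ-+
      }
    ; *-comm = *-comm
    }

  +-*-commutativeRing : CommutativeRing _ _
  +-*-commutativeRing = record { isCommutativeRing = +-*-isCommutativeRing }

  -- Deciding equality with 0# lets the solver normalise coefficients, so identities involving
  -- the constants i and π are solved by computing in ℤ[i].
  ℤ[i]-ring : AlmostCommutativeRing _ _
  ℤ[i]-ring = fromCommutativeRing +-*-commutativeRing (λ x → dec⇒maybe (0# ≟ x))

module PiAdicDigits where

  open import Data.Bool using (Bool; true; false; not; _xor_)
  open import Data.Integer as ℤ using (ℤ; +_; -[1+_])
  open import Data.Integer.Properties as ℤ using ()
  open import Data.Integer.Solver using (module +-*-Solver)
  open import Data.List using (_∷_; [])
  open import Data.Product using (_×_; _,_; proj₁; proj₂; ∃-syntax)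
  open import Function using (_∋_)
  open import Relation.Binary.PropositionalEquality
  open import Tactic.RingSolver using (solve; solve-∀)
  open ≡-Reasoning
  open +-*-Solver using (_:+_; _:*_; :-_; _:-_; _:=_; con) renaming (solve to ℤ-solve)
  open IntegerHalving
  open GaussianIntegers

  digit : Bool → ℤ[i]
  digit c = bit c ,, + 0

  dig : ℤ[i] → Bool
  dig (a ,, b) = proj₁ (halve (a ℤ.+ b))

  quo : ℤ[i] → ℤ[i]
  quo (a ,, b) = ℤ.- h ,, h ℤ.- b
    where
    h : ℤ
    h = proj₂ (halve (a ℤ.+ b))

  digit+π*quo : ∀ x → digit (dig x) + π * quo x ≡ x
  digit+π*quo (a ,, b) = expand (bit (proj₁ (halve (a ℤ.+ b)))) (proj₂ (halve (a ℤ.+ b))) (halve-correct (a ℤ.+ b))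
    where
    expand : ∀ k h → a ℤ.+ b ≡ k ℤ.+ (h ℤ.+ h) → (k ,, + 0) + π * (ℤ.- h ,, h ℤ.- b) ≡ (a ,, b)
    expand k h a+b≡ = cong₂ _,,_
      (begin
        k ℤ.+ (-[1+ 0 ] ℤ.* ℤ.- h ℤ.- -[1+ 0 ] ℤ.* (h ℤ.- b))
          ≡⟨ ℤ-solve 3 (λ k h b → k :+ (con -[1+ 0 ] :* (:- h) :- con -[1+ 0 ] :* (h :- b))
                             := k :+ (h :+ h) :- b) refl k h b ⟩
        k ℤ.+ (h ℤ.+ h) ℤ.- b
          ≡⟨ cong (ℤ._- b) a+b≡ ⟨
        a ℤ.+ b ℤ.- b
          ≡⟨ ℤ-solve 2 (λ a b → a :+ b :- b := a) refl a b ⟩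
        a ∎)
      (ℤ-solve 2 (λ h b → con (+ 0) :+ (con -[1+ 0 ] :* (h :- b) :+ con -[1+ 0 ] :* (:- h)) := b) refl h b)

  dig-quo-unique : ∀ c q → dig (digit c + π * q) ≡ c × quo (digit c + π * q) ≡ q
  dig-quo-unique c (q₁ ,, q₂) = cong proj₁ halving , (begin
      ℤ.- proj₂ (halve (re ℤ.+ im)) ,, proj₂ (halve (re ℤ.+ im)) ℤ.- im
        ≡⟨ cong (λ h → ℤ.- h ,, h ℤ.- im) (cong proj₂ halving) ⟩
      ℤ.- ℤ.- q₁ ,, ℤ.- q₁ ℤ.- im
        ≡⟨ cong₂ _,,_ (ℤ.neg-involutive q₁)
             (ℤ-solve 2 (λ q₁ q₂ → :- q₁ :- (con (+ 0) :+ (con -[1+ 0 ] :* q₂ :+ con -[1+ 0 ] :* q₁)) := q₂)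
                      refl q₁ q₂) ⟩
      q₁ ,, q₂ ∎)
    where
    re im : ℤ
    re = bit c ℤ.+ (-[1+ 0 ] ℤ.* q₁ ℤ.- -[1+ 0 ] ℤ.* q₂)
    im = + 0 ℤ.+ (-[1+ 0 ] ℤ.* q₂ ℤ.+ -[1+ 0 ] ℤ.* q₁)
    re+im : ∀ k → k ℤ.+ (-[1+ 0 ] ℤ.* q₁ ℤ.- -[1+ 0 ] ℤ.* q₂) ℤ.+ im ≡ k ℤ.+ (ℤ.- q₁ ℤ.+ ℤ.- q₁)
    re+im k = ℤ-solve 3 (λ k q₁ q₂ → k :+ (con -[1+ 0 ] :* q₁ :- con -[1+ 0 ] :* q₂)
                                       :+ (con (+ 0) :+ (con -[1+ 0 ] :* q₂ :+ con -[1+ 0 ] :* q₁))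
                                  := k :+ (:- q₁ :+ :- q₁)) refl k q₁ q₂
    halving : halve (re ℤ.+ im) ≡ (c , ℤ.- q₁)
    halving = trans (cong halve (re+im (bit c))) (halve-bit+double c (ℤ.- q₁))

  dig-digit+π* : ∀ {x} c q → x ≡ digit c + π * q → dig x ≡ c
  dig-digit+π* c q refl = proj₁ (dig-quo-unique c q)

  carry : Bool → Bool → ℤ[i]
  carry true true = - 1# + i
  carry _    _    = 0#

  digit-+ : ∀ a b q r → digit a + π * q + (digit b + π * r) ≡ digit (a xor b) + π * (q + r + carry a b)
  digit-+ false false q r = solve (q ∷ r ∷ []) ℤ[i]-ring
  digit-+ false true  q r = solve (q ∷ r ∷ []) ℤ[i]-ring
  digit-+ true  false q r = solve (q ∷ r ∷ []) ℤ[i]-ring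
  digit-+ true  true  q r = solve (q ∷ r ∷ []) ℤ[i]-ring

  dig-+ : ∀ x y → dig (x + y) ≡ dig x xor dig y
  dig-+ x y = dig-digit+π* (dig x xor dig y) (quo x + quo y + carry (dig x) (dig y)) (begin
    x + y                                                                  ≡⟨ cong₂ _+_ (digit+π*quo x) (digit+π*quo y) ⟨
    digit (dig x) + π * quo x + (digit (dig y) + π * quo y)                ≡⟨ digit-+ (dig x) (dig y) (quo x) (quo y) ⟩
    digit (dig x xor dig y) + π * (quo x + quo y + carry (dig x) (dig y))  ∎)

  digit-neg : ∀ c q → - (digit c + π * q) ≡ digit c + π * (- q + - carry c c)
  digit-neg false q = solve (q ∷ []) ℤ[i]-ring
  digit-neg true  q = solve (q ∷ []) ℤ[i]-ring

  dig-neg : ∀ x → dig (- x) ≡ dig x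
  dig-neg x = dig-digit+π* (dig x) (- quo x + - carry (dig x) (dig x)) (begin
    - x                                                      ≡⟨ cong -_ (digit+π*quo x) ⟨
    - (digit (dig x) + π * quo x)                            ≡⟨ digit-neg (dig x) (quo x) ⟩
    digit (dig x) + π * (- quo x + - carry (dig x) (dig x))  ∎)

  Odd : ℤ[i] → Set
  Odd u = dig u ≡ true

  Odd-+ : ∀ {u} → Odd u → ∀ d → dig (u + d) ≡ not (dig d)
  Odd-+ {u} odd d = trans (dig-+ u d) (cong (_xor dig d) odd)

  Odd-* : ∀ {u v} → Odd u → Odd v → Odd (u * v)
  Odd-* {u} {v} odd-u odd-v = dig-digit+π* true (quo u + quo v + π * quo u * quo v) (begin
    u * v                                          ≡⟨ cong₂ _*_ (expand odd-u) (expand odd-v) ⟩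
    (1# + π * quo u) * (1# + π * quo v)            ≡⟨ product (quo u) (quo v) ⟩
    1# + π * (quo u + quo v + π * quo u * quo v)   ∎)
    where
    expand : ∀ {w} → Odd w → w ≡ 1# + π * quo w
    expand {w} odd = trans (sym (digit+π*quo w)) (cong (λ c → digit c + π * quo w) odd)
    product : ∀ s t → (1# + π * s) * (1# + π * t) ≡ 1# + π * (s + t + π * s * t)
    product = solve-∀ ℤ[i]-ring

  twist : Bool → ℤ[i] → ℤ[i]
  twist false x = x
  twist true  x = - x

  twist-involutive : ∀ c x → twist c (twist c x) ≡ x
  twist-involutive false x = refl
  twist-involutive true  = (∀ x → - - x ≡ x) ∋ solve-∀ ℤ[i]-ring

  Odd-twist : ∀ c {u} → Odd u → Odd (twist c u)
  Odd-twist false     odd = odd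
  Odd-twist true  {u} odd = trans (dig-neg u) odd

  cons : Bool → ℤ[i] → ℤ[i]
  cons c y = digit c + π * twist c y

  shift : ℤ[i] → ℤ[i]
  shift x = twist (dig x) (quo x)

  cons-dig-shift : ∀ x → cons (dig x) (shift x) ≡ x
  cons-dig-shift x = trans (cong (λ y → digit (dig x) + π * y) (twist-involutive (dig x) (quo x))) (digit+π*quo x)

  dig-cons : ∀ c y → dig (cons c y) ≡ c
  dig-cons c y = proj₁ (dig-quo-unique c (twist c y))

  shift-cons : ∀ c y → shift (cons c y) ≡ y
  shift-cons c y = begin
    twist (dig (cons c y)) (quo (cons c y))  ≡⟨ cong₂ twist (dig-cons c y) (proj₂ (dig-quo-unique c (twist c y))) ⟩
    twist c (twist c y)                      ≡⟨ twist-involutive c y ⟩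
    y                                        ∎

  infix 4 _≡_[mod_]
  _≡_[mod_] : ℤ[i] → ℤ[i] → ℤ[i] → Set
  x ≡ y [mod m ] = ∃[ k ] y ≡ x + m * k

  ≡-mod-refl : ∀ {m} x → x ≡ x [mod m ]
  ≡-mod-refl {m} x = 0# , solve (x ∷ m ∷ []) ℤ[i]-ring

  ≡-mod-1# : ∀ x y → x ≡ y [mod 1# ]
  ≡-mod-1# x y = y + - x , solve (x ∷ y ∷ []) ℤ[i]-ring

  +-cong-mod : ∀ {m x y x′ y′} → x ≡ y [mod m ] → x′ ≡ y′ [mod m ] → x + x′ ≡ y + y′ [mod m ]
  +-cong-mod {m} {x} {x′ = x′} (k , refl) (k′ , refl) = k + k′ , solve (m ∷ x ∷ x′ ∷ k ∷ k′ ∷ []) ℤ[i]-ring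

  *-cong-mod : ∀ {m x y x′ y′} → x ≡ y [mod m ] → x′ ≡ y′ [mod m ] → x * x′ ≡ y * y′ [mod m ]
  *-cong-mod {m} {x} {x′ = x′} (k , refl) (k′ , refl) =
    k * x′ + x * k′ + m * k * k′ , solve (m ∷ x ∷ x′ ∷ k ∷ k′ ∷ []) ℤ[i]-ring

  +-cancelʳ-mod : ∀ {m x y z z′} → x + z ≡ y + z′ [mod m ] → z ≡ z′ [mod m ] → x ≡ y [mod m ]
  +-cancelʳ-mod {m} {x} {y} {z} (k , y+z′≡) (k′ , refl) = k + - k′ , (begin
    y                                   ≡⟨ solve (y ∷ z ∷ m ∷ k′ ∷ []) ℤ[i]-ring ⟩
    y + (z + m * k′) + - (z + m * k′)   ≡⟨ cong (_+ - (z + m * k′)) y+z′≡ ⟩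
    x + z + m * k + - (z + m * k′)      ≡⟨ solve (x ∷ z ∷ m ∷ k ∷ k′ ∷ []) ℤ[i]-ring ⟩
    x + m * (k + - k′)                  ∎)

  cons-+ : ∀ c s m k → cons c s + π * m * k ≡ cons c (s + m * twist c k)
  cons-+ false = (∀ s m k → digit false + π * s + π * m * k ≡ digit false + π * (s + m * k)) ∋ solve-∀ ℤ[i]-ring
  cons-+ true  = (∀ s m k → digit true + π * - s + π * m * k ≡ digit true + π * - (s + m * - k)) ∋ solve-∀ ℤ[i]-ring

  ≡-mod-π*⇒ : ∀ {m x y} → x ≡ y [mod π * m ] → dig x ≡ dig y × (shift x ≡ shift y [mod m ])
  ≡-mod-π*⇒ {m} {x} (k , refl) =
    sym (trans (cong dig y≡) (dig-cons (dig x) _)) , twist (dig x) k , trans (cong shift y≡) (shift-cons (dig x) _)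
    where
    y≡ : x + π * m * k ≡ cons (dig x) (shift x + m * twist (dig x) k)
    y≡ = trans (cong (λ z → z + π * m * k) (sym (cons-dig-shift x))) (cons-+ (dig x) (shift x) m k)

  ≡-mod-π*⇐ : ∀ {m x y} → dig x ≡ dig y → shift x ≡ shift y [mod m ] → x ≡ y [mod π * m ]
  ≡-mod-π*⇐ {m} {x} {y} dx≡dy (k , shift-y≡) = twist c k , (begin
    y                                            ≡⟨ cons-dig-shift y ⟨
    cons (dig y) (shift y)                       ≡⟨ cong₂ cons (sym dx≡dy) shift-y≡ ⟩
    cons c (shift x + m * k)                     ≡⟨ cong (λ t → cons c (shift x + m * t)) (twist-involutive c k) ⟨
    cons c (shift x + m * twist c (twist c k))   ≡⟨ cons-+ c (shift x) m (twist c k) ⟨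
    cons c (shift x) + π * m * twist c k         ≡⟨ cong (λ z → z + π * m * twist c k) (cons-dig-shift x) ⟩
    x + π * m * twist c k                        ∎)
    where
    c : Bool
    c = dig x

module PiAdicWords where

  open import Data.Bool using (Bool)
  open import Data.Nat using (ℕ; zero; suc; _≤_; z≤n; s≤s)
  open import Data.Product using (_,_)
  open import Data.Vec using (Vec; []; _∷_)
  open import Data.Vec.Properties using (∷-injective)
  open import Relation.Binary.PropositionalEquality
  open GaussianIntegers
  open PiAdicDigits

  Word : ℕ → Set
  Word = Vec Bool

  π^ : ℕ → ℤ[i]
  π^ zero    = 1#
  π^ (suc n) = π * π^ n

  decode : ∀ {n} → Word n → ℤ[i]
  decode []      = 0#
  decode (c ∷ w) = cons c (decode w)

  encode : ∀ n → ℤ[i] → Word n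
  encode zero    x = []
  encode (suc n) x = dig x ∷ encode n (shift x)

  encode-cons : ∀ n c y → encode (suc n) (cons c y) ≡ c ∷ encode n y
  encode-cons n c y = cong₂ _∷_ (dig-cons c y) (cong (encode n) (shift-cons c y))

  encode-decode : ∀ {n} (w : Word n) → encode n (decode w) ≡ w
  encode-decode []      = refl
  encode-decode (c ∷ w) = trans (encode-cons _ c (decode w)) (cong (c ∷_) (encode-decode w))

  ≡-mod⇒encode-≡ : ∀ n {x y} → x ≡ y [mod π^ n ] → encode n x ≡ encode n y
  ≡-mod⇒encode-≡ zero    _ = refl
  ≡-mod⇒encode-≡ (suc n) x≡y with ≡-mod-π*⇒ x≡y
  ... | dx≡dy , shifts≡ = cong₂ _∷_ dx≡dy (≡-mod⇒encode-≡ n shifts≡)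

  encode-≡⇒≡-mod : ∀ n {x y} → encode n x ≡ encode n y → x ≡ y [mod π^ n ]
  encode-≡⇒≡-mod zero    {x} {y} _ = ≡-mod-1# x y
  encode-≡⇒≡-mod (suc n) eq with ∷-injective eq
  ... | dx≡dy , tails≡ = ≡-mod-π*⇐ dx≡dy (encode-≡⇒≡-mod n tails≡)

  decode-encode : ∀ n x → decode (encode n x) ≡ x [mod π^ n ]
  decode-encode n x = encode-≡⇒≡-mod n (encode-decode (encode n x))

  encode-≤ : ∀ {m n} → m ≤ n → ∀ {x y} → encode n x ≡ encode n y → encode m x ≡ encode m y
  encode-≤ z≤n       _ = refl
  encode-≤ (s≤s m≤n) eq with ∷-injective eq
  ... | dx≡dy , tails≡ = cong₂ _∷_ dx≡dy (encode-≤ m≤n tails≡)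

module TreeAction where

  open import Data.Bool using (true; false; not)
  open import Data.Bool.Properties using (not-involutive)
  open import Data.Nat using (ℕ; zero; suc)
  open import Data.Product using (_,_; proj₁; proj₂)
  open import Data.Vec using ([]; _∷_; replicate)
  open import Data.Vec.Properties using (∷-injectiveˡ; ∷-injectiveʳ)
  open import Function using (_∘_)
  open import Relation.Binary.PropositionalEquality
  open PiAdicWords using (Word)

  act : ∀ n → Aut n → Word n → Word n
  act zero    _              []          = []
  act (suc n) (x₁ , x₂ , τ) (false ∷ w) = τ ∷ act n x₁ w
  act (suc n) (x₁ , x₂ , τ) (true  ∷ w) = not τ ∷ act n x₂ w

  act-mul : ∀ n x y w → act n (mul n x y) w ≡ act n y (act n x w)
  act-mul zero    _                  _              []          = refl
  act-mul (suc n) (x₁ , x₂ , false) (y₁ , y₂ , τ) (false ∷ w) = cong (τ ∷_) (act-mul n x₁ y₁ w)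
  act-mul (suc n) (x₁ , x₂ , false) (y₁ , y₂ , τ) (true  ∷ w) = cong (not τ ∷_) (act-mul n x₂ y₂ w)
  act-mul (suc n) (x₁ , x₂ , true)  (y₁ , y₂ , τ) (false ∷ w) = cong (not τ ∷_) (act-mul n x₁ y₂ w)
  act-mul (suc n) (x₁ , x₂ , true)  (y₁ , y₂ , τ) (true  ∷ w) = cong₂ _∷_ (not-involutive τ) (act-mul n x₂ y₁ w)

  act-injective : ∀ n {x y} → (∀ w → act n x w ≡ act n y w) → x ≡ y
  act-injective zero    _ = refl
  act-injective (suc n) {x₁ , x₂ , τ} {y₁ , y₂ , σ} x≗y =
    cong₂ _,_ (act-injective n (λ w → ∷-injectiveʳ (x≗y (false ∷ w))))
              (cong₂ _,_ (act-injective n (λ w → ∷-injectiveʳ (x≗y (true ∷ w))))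
                         (∷-injectiveˡ (x≗y (false ∷ replicate n false))))

  inv-unique : ∀ n x y → mul n x y ≡ e n → inv n x ≡ y
  inv-unique zero    _                  _                  _    = refl
  inv-unique (suc n) (x₁ , x₂ , false) (y₁ , y₂ , false) xy≡e =
    cong₂ (λ z₁ z₂ → z₁ , z₂ , false) (inv-unique n x₁ y₁ (cong proj₁ xy≡e))
                                      (inv-unique n x₂ y₂ (cong (proj₁ ∘ proj₂) xy≡e))
  inv-unique (suc n) (x₁ , x₂ , true)  (y₁ , y₂ , true)  xy≡e =
    cong₂ (λ z₁ z₂ → z₁ , z₂ , true) (inv-unique n x₂ y₁ (cong (proj₁ ∘ proj₂) xy≡e))
                                     (inv-unique n x₁ y₂ (cong proj₁ xy≡e))
  inv-unique (suc n) (_ , _ , false)   (_ , _ , true)    ()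
  inv-unique (suc n) (_ , _ , true)    (_ , _ , false)   ()

module AffineAutomorphisms where

  open import Data.Bool using (true; false; not)
  open import Data.Bool.Properties using (not-involutive)
  open import Data.List using (_∷_; [])
  open import Data.Nat using (ℕ; zero; suc)
  open import Data.Product using (_×_; _,_)
  open import Data.Unit using (tt)
  open import Data.Vec as Vec using ()
  open import Function using (_∋_)
  open import Relation.Binary.PropositionalEquality
  open import Tactic.RingSolver using (solve)
  open ≡-Reasoning
  open GaussianIntegers
  open PiAdicDigits
  open PiAdicWords
  open TreeAction

  -- Restricted to the half cons c _ of ℤ[i], z ↦ u z + d is again affine (affine-cons-false/true);
  -- the two subtrees carry these restrictions.
  affine : ∀ n → ℤ[i] → ℤ[i] → Aut n
  affine zero    u d = tt
  affine (suc n) u d = affine n u′ (shift d) , affine n u′ (shift (u + d)) , dig d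
    where
    u′ : ℤ[i]
    u′ = twist (dig d) u

  affine-cons-false : ∀ u y d → u * cons false y + d ≡ cons (dig d) (twist (dig d) u * y + shift d)
  affine-cons-false u y d = begin
    u * cons false y + d                           ≡⟨ cong (u * cons false y +_) (cons-dig-shift d) ⟨
    u * cons false y + cons (dig d) (shift d)      ≡⟨ shape (dig d) (shift d) ⟩
    cons (dig d) (twist (dig d) u * y + shift d)   ∎
    where
    shape : ∀ c s → u * cons false y + cons c s ≡ cons c (twist c u * y + s)
    shape false s = (u * (digit false + π * y) + (digit false + π * s) ≡ digit false + π * (u * y + s))
                      ∋ solve (u ∷ y ∷ s ∷ []) ℤ[i]-ring
    shape true  s = (u * (digit false + π * y) + (digit true + π * - s) ≡ digit true + π * - (- u * y + s))
                      ∋ solve (u ∷ y ∷ s ∷ []) ℤ[i]-ring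

  affine-cons-true : ∀ {u} → Odd u → ∀ y d →
                     u * cons true y + d ≡ cons (not (dig d)) (twist (dig d) u * y + shift (u + d))
  affine-cons-true {u} odd y d = begin
    u * cons true y + d
      ≡⟨ regroup ⟩
    u + d + π * - (u * y)
      ≡⟨ cong (_+ π * - (u * y)) (cons-dig-shift (u + d)) ⟨
    cons (dig (u + d)) (shift (u + d)) + π * - (u * y)
      ≡⟨ shape (dig (u + d)) (shift (u + d)) ⟩
    cons (dig (u + d)) (twist (not (dig (u + d))) u * y + shift (u + d))
      ≡⟨ cong (λ c → cons c (twist (not c) u * y + shift (u + d))) (Odd-+ {u} odd d) ⟩
    cons (not (dig d)) (twist (not (not (dig d))) u * y + shift (u + d))
      ≡⟨ cong (λ c → cons (not (dig d)) (twist c u * y + shift (u + d))) (not-involutive (dig d)) ⟩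
    cons (not (dig d)) (twist (dig d) u * y + shift (u + d))
      ∎
    where
    regroup : u * (digit true + π * - y) + d ≡ u + d + π * - (u * y)
    regroup = solve (u ∷ y ∷ d ∷ []) ℤ[i]-ring
    shape : ∀ c s → cons c s + π * - (u * y) ≡ cons c (twist (not c) u * y + s)
    shape false s = (digit false + π * s + π * - (u * y) ≡ digit false + π * (- u * y + s))
                      ∋ solve (u ∷ y ∷ s ∷ []) ℤ[i]-ring
    shape true  s = (digit true + π * - s + π * - (u * y) ≡ digit true + π * - (u * y + s))
                      ∋ solve (u ∷ y ∷ s ∷ []) ℤ[i]-ring

  act-affine : ∀ n {u} → Odd u → ∀ d w → act n (affine n u d) w ≡ encode n (u * decode w + d)
  act-affine zero    _       _ Vec.[]          = refl
  act-affine (suc n) {u} odd d (false Vec.∷ w) = begin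
    dig d Vec.∷ act n (affine n u′ (shift d)) w
      ≡⟨ cong (dig d Vec.∷_) (act-affine n (Odd-twist (dig d) odd) (shift d) w) ⟩
    dig d Vec.∷ encode n (u′ * decode w + shift d)
      ≡⟨ encode-cons n (dig d) _ ⟨
    encode (suc n) (cons (dig d) (u′ * decode w + shift d))
      ≡⟨ cong (encode (suc n)) (affine-cons-false u (decode w) d) ⟨
    encode (suc n) (u * cons false (decode w) + d)
      ∎
    where
    u′ : ℤ[i]
    u′ = twist (dig d) u
  act-affine (suc n) {u} odd d (true Vec.∷ w) = begin
    not (dig d) Vec.∷ act n (affine n u′ (shift (u + d))) w
      ≡⟨ cong (not (dig d) Vec.∷_) (act-affine n (Odd-twist (dig d) odd) (shift (u + d)) w) ⟩
    not (dig d) Vec.∷ encode n (u′ * decode w + shift (u + d))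
      ≡⟨ encode-cons n (not (dig d)) _ ⟨
    encode (suc n) (cons (not (dig d)) (u′ * decode w + shift (u + d)))
      ≡⟨ cong (encode (suc n)) (affine-cons-true odd (decode w) d) ⟨
    encode (suc n) (u * cons true (decode w) + d)
      ∎
    where
    u′ : ℤ[i]
    u′ = twist (dig d) u

  act-affine-encode : ∀ n {u} → Odd u → ∀ d z → act n (affine n u d) (encode n z) ≡ encode n (u * z + d)
  act-affine-encode n {u} odd d z = trans (act-affine n odd d (encode n z))
    (≡-mod⇒encode-≡ n (+-cong-mod (*-cong-mod (≡-mod-refl u) (decode-encode n z)) (≡-mod-refl d)))

  act-encode-injective : ∀ n {x y} → (∀ z → act n x (encode n z) ≡ act n y (encode n z)) → x ≡ y
  act-encode-injective n {x} {y} x≗y =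
    act-injective n λ w → subst (λ v → act n x v ≡ act n y v) (encode-decode w) (x≗y (decode w))

  affine-mul : ∀ n {u u′} → Odd u → Odd u′ → ∀ d d′ →
               mul n (affine n u d) (affine n u′ d′) ≡ affine n (u * u′) (u′ * d + d′)
  affine-mul n {u} {u′} odd odd′ d d′ = act-encode-injective n λ z → begin
    act n (mul n (affine n u d) (affine n u′ d′)) (encode n z)
      ≡⟨ act-mul n _ _ (encode n z) ⟩
    act n (affine n u′ d′) (act n (affine n u d) (encode n z))
      ≡⟨ cong (act n (affine n u′ d′)) (act-affine-encode n odd d z) ⟩
    act n (affine n u′ d′) (encode n (u * z + d))
      ≡⟨ act-affine-encode n odd′ d′ (u * z + d) ⟩
    encode n (u′ * (u * z + d) + d′)
      ≡⟨ cong (encode n) (solve (u ∷ u′ ∷ d ∷ d′ ∷ z ∷ []) ℤ[i]-ring) ⟩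
    encode n (u * u′ * z + (u′ * d + d′))
      ≡⟨ act-affine-encode n (Odd-* {u} {u′} odd odd′) (u′ * d + d′) z ⟨
    act n (affine n (u * u′) (u′ * d + d′)) (encode n z)
      ∎

  affine-identity : ∀ n → affine n 1# 0# ≡ e n
  affine-identity zero    = refl
  affine-identity (suc n) = cong (λ x → x , x , false) (affine-identity n)

  affine-inv : ∀ n {u u′} → Odd u → Odd u′ → u * u′ ≡ 1# →
               ∀ d → inv n (affine n u d) ≡ affine n u′ (- (u′ * d))
  affine-inv n {u} {u′} odd odd′ uu′≡1 d = inv-unique n _ _ (begin
    mul n (affine n u d) (affine n u′ (- (u′ * d)))  ≡⟨ affine-mul n odd odd′ d (- (u′ * d)) ⟩
    affine n (u * u′) (u′ * d + - (u′ * d))          ≡⟨ cong₂ (affine n) uu′≡1 (solve (u′ ∷ d ∷ []) ℤ[i]-ring) ⟩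
    affine n 1# 0#                                   ≡⟨ affine-identity n ⟩
    e n                                              ∎)

  affine-cong : ∀ n {u} → Odd u → ∀ {d d′} → d ≡ d′ [mod π^ n ] → affine n u d ≡ affine n u d′
  affine-cong n {u} odd {d} {d′} d≡d′ = act-encode-injective n λ z → begin
    act n (affine n u d) (encode n z)   ≡⟨ act-affine-encode n odd d z ⟩
    encode n (u * z + d)                ≡⟨ ≡-mod⇒encode-≡ n (+-cong-mod (≡-mod-refl (u * z)) d≡d′) ⟩
    encode n (u * z + d′)               ≡⟨ act-affine-encode n odd d′ z ⟨
    act n (affine n u d′) (encode n z)  ∎

  affine-injective : ∀ n {u u′ d d′} → Odd u → Odd u′ → affine n u d ≡ affine n u′ d′ →
                     u ≡ u′ [mod π^ n ] × d ≡ d′ [mod π^ n ]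
  affine-injective n {u} {u′} {d} {d′} odd odd′ eq = +-cancelʳ-mod u+d≡u′+d′ d≡d′ , d≡d′
    where
    at : ∀ z {x x′} → u * z + d ≡ x → u′ * z + d′ ≡ x′ → x ≡ x′ [mod π^ n ]
    at z refl refl = encode-≡⇒≡-mod n (begin
      encode n (u * z + d)                 ≡⟨ act-affine-encode n odd d z ⟨
      act n (affine n u d) (encode n z)    ≡⟨ cong (λ x → act n x (encode n z)) eq ⟩
      act n (affine n u′ d′) (encode n z)  ≡⟨ act-affine-encode n odd′ d′ z ⟩
      encode n (u′ * z + d′)               ∎)
    d≡d′ : d ≡ d′ [mod π^ n ]
    d≡d′ = at 0# {d} {d′} (solve (u ∷ d ∷ []) ℤ[i]-ring) (solve (u′ ∷ d′ ∷ []) ℤ[i]-ring)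
    u+d≡u′+d′ : u + d ≡ u′ + d′ [mod π^ n ]
    u+d≡u′+d′ = at 1# {u + d} {u′ + d′} (solve (u ∷ d ∷ []) ℤ[i]-ring) (solve (u′ ∷ d′ ∷ []) ℤ[i]-ring)

module AffineModel where

  open import Data.Bool using (true; false)
  import Data.Bool.Properties as Bool
  open import Data.Fin as Fin using (Fin)
  open import Data.Fin.Patterns using (0F; 1F; 2F; 3F)
  open import Data.Fin.Properties using (all?; any?)
  open import Data.List using (_∷_; [])
  open import Data.Nat using (ℕ; zero; suc)
  open import Data.Product using (_×_; _,_; proj₁; proj₂; ∃-syntax)
  open import Data.Vec as Vec using ()
  open import Data.Vec.Properties using (≡-dec)
  open import Relation.Binary.PropositionalEquality
  open import Relation.Nullary.Decidable using (from-yes; _→-dec_)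
  open import Tactic.RingSolver using (solve; solve-∀)
  open ≡-Reasoning
  open GaussianIntegers
  open PiAdicDigits
  open PiAdicWords
  open AffineAutomorphisms

  a₁≡affine : ∀ n → a₁ n ≡ affine n (- 1#) 1#
  a₁≡affine zero    = refl
  a₁≡affine (suc n) = cong (λ x → x , x , true) (sym (affine-identity n))

  a₂a₃≡affine : ∀ n → a₂ n ≡ affine n i (- 1#) × a₃ n ≡ affine n i (1# + i)
  a₂a₃≡affine zero = refl , refl
  a₂a₃≡affine (suc n) with a₂a₃≡affine n
  ... | a₂≡ , a₃≡ = cong₂ (λ x y → x , y , true) (inverse a₃≡) (inverse a₂≡) ,
                    cong₂ (λ x y → x , y , false) a₂≡ a₃≡
    where
    inverse : ∀ {x d} → x ≡ affine n i d → inv n x ≡ affine n (- i) (- (- i * d))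
    inverse refl = affine-inv n refl refl refl _

  a₂≡affine : ∀ n → a₂ n ≡ affine n i (- 1#)
  a₂≡affine n = proj₁ (a₂a₃≡affine n)

  a₃≡affine : ∀ n → a₃ n ≡ affine n i (1# + i)
  a₃≡affine n = proj₂ (a₂a₃≡affine n)

  a₂⁻¹≡affine : ∀ n → inv n (a₂ n) ≡ affine n (- i) (- i)
  a₂⁻¹≡affine n = trans (cong (inv n) (a₂≡affine n)) (affine-inv n refl refl refl (- 1#))

  unit : Fin 4 → ℤ[i]
  unit 0F = 1#
  unit 1F = i
  unit 2F = - 1#
  unit 3F = - i

  unit-odd : ∀ j → Odd (unit j)
  unit-odd 0F = refl
  unit-odd 1F = refl
  unit-odd 2F = refl
  unit-odd 3F = refl

  unit-*-closed : ∀ j k → ∃[ l ] unit j * unit k ≡ unit l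
  unit-*-closed = from-yes (all? λ j → all? λ k → any? λ l → unit j * unit k ≟ unit l)

  unit-inverse : ∀ j → ∃[ k ] unit j * unit k ≡ 1#
  unit-inverse = from-yes (all? λ j → any? λ k → unit j * unit k ≟ 1#)

  unit-injective-mod-π³ : ∀ j k → encode 3 (unit j) ≡ encode 3 (unit k) → j ≡ k
  unit-injective-mod-π³ =
    from-yes (all? λ j → all? λ k → ≡-dec Bool._≟_ (encode 3 (unit j)) (encode 3 (unit k)) →-dec j Fin.≟ k)

  module Translations (n : ℕ) where

    Translation∈G : ℤ[i] → Set
    Translation∈G t = InG n (affine n 1# t)

    0∈G : Translation∈G 0#
    0∈G = subst (InG n) (sym (affine-identity n)) g-e

    +-∈G : ∀ {t t′} → Translation∈G t → Translation∈G t′ → Translation∈G (t + t′)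
    +-∈G {t} {t′} t∈G t′∈G = subst (InG n) compose (g-mul t∈G t′∈G)
      where
      compose : mul n (affine n 1# t) (affine n 1# t′) ≡ affine n 1# (t + t′)
      compose = trans (affine-mul n refl refl t t′) (cong (affine n 1#) (solve (t ∷ t′ ∷ []) ℤ[i]-ring))

    neg-∈G : ∀ {t} → Translation∈G t → Translation∈G (- t)
    neg-∈G {t} t∈G = subst (InG n) invert (g-inv t∈G)
      where
      invert : inv n (affine n 1# t) ≡ affine n 1# (- t)
      invert = trans (affine-inv n refl refl refl t) (cong (affine n 1#) (solve (t ∷ []) ℤ[i]-ring))

    i*-∈G : ∀ {t} → Translation∈G t → Translation∈G (i * t)
    i*-∈G {t} t∈G = subst (InG n) conjugate (g-mul (g-mul (g-inv (g-gen 1F)) t∈G) (g-gen 1F))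
      where
      conjugate : mul n (mul n (inv n (a₂ n)) (affine n 1# t)) (a₂ n) ≡ affine n 1# (i * t)
      conjugate = begin
        mul n (mul n (inv n (a₂ n)) (affine n 1# t)) (a₂ n)
          ≡⟨ cong₂ (λ x y → mul n (mul n x (affine n 1# t)) y) (a₂⁻¹≡affine n) (a₂≡affine n) ⟩
        mul n (mul n (affine n (- i) (- i)) (affine n 1# t)) (affine n i (- 1#))
          ≡⟨ cong (λ x → mul n x (affine n i (- 1#))) (affine-mul n refl refl (- i) t) ⟩
        mul n (affine n (- i * 1#) (1# * - i + t)) (affine n i (- 1#))
          ≡⟨ affine-mul n refl refl (1# * - i + t) (- 1#) ⟩
        affine n (- i * 1# * i) (i * (1# * - i + t) + - 1#)
          ≡⟨ cong (affine n 1#) (solve (t ∷ []) ℤ[i]-ring) ⟩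
        affine n 1# (i * t)
          ∎

    π*-∈G : ∀ {t} → Translation∈G t → Translation∈G (π * t)
    π*-∈G {t} t∈G = subst Translation∈G (π≡-1-i t) (+-∈G (neg-∈G t∈G) (neg-∈G (i*-∈G t∈G)))
      where
      π≡-1-i : ∀ t → - t + - (i * t) ≡ π * t
      π≡-1-i = solve-∀ ℤ[i]-ring

    1-π∈G : Translation∈G (1# + - π)
    1-π∈G = subst (InG n) a₂⁻¹a₃≡ (g-mul (g-inv (g-gen 1F)) (g-gen 2F))
      where
      a₂⁻¹a₃≡ : mul n (inv n (a₂ n)) (a₃ n) ≡ affine n (- i * i) (i * - i + (1# + i))
      a₂⁻¹a₃≡ = trans (cong₂ (mul n) (a₂⁻¹≡affine n) (a₃≡affine n)) (affine-mul n refl refl (- i) (1# + i))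

    geometric : ℕ → ℤ[i]
    geometric zero    = 0#
    geometric (suc k) = 1# + π * geometric k

    geometric-∈G : ∀ k → Translation∈G ((1# + - π) * geometric k)
    geometric-∈G zero    = 0∈G
    geometric-∈G (suc k) = subst Translation∈G (expand (geometric k)) (+-∈G 1-π∈G (π*-∈G (geometric-∈G k)))
      where
      expand : ∀ g → 1# + - π + π * ((1# + - π) * g) ≡ (1# + - π) * (1# + π * g)
      expand = solve-∀ ℤ[i]-ring

    geometric-≡-1 : ∀ k → (1# + - π) * geometric k ≡ 1# [mod π^ k ]
    geometric-≡-1 k = 1# , sym (telescope k)
      where
      telescope : ∀ k → (1# + - π) * geometric k + π^ k * 1# ≡ 1#
      telescope zero    = refl
      telescope (suc k) = begin
        (1# + - π) * (1# + π * geometric k) + π * π^ k * 1#    ≡⟨ expand (geometric k) (π^ k) ⟩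
        1# + - π + π * ((1# + - π) * geometric k + π^ k * 1#)  ≡⟨ cong (λ x → 1# + - π + π * x) (telescope k) ⟩
        1# + - π + π * 1#                                      ≡⟨⟩
        1#                                                     ∎
        where
        expand : ∀ g p → (1# + - π) * (1# + π * g) + π * p * 1# ≡ 1# + - π + π * ((1# + - π) * g + p * 1#)
        expand = solve-∀ ℤ[i]-ring

    1∈G : Translation∈G 1#
    1∈G = subst (InG n) (affine-cong n refl (geometric-≡-1 n)) (geometric-∈G n)

    decode-∈G : ∀ {k} (w : Word k) → Translation∈G (decode w)
    decode-∈G Vec.[]      = 0∈G
    decode-∈G (c Vec.∷ w) = +-∈G (digit-∈G c) (π*-∈G (twist-∈G c (decode-∈G w)))
      where
      digit-∈G : ∀ c → Translation∈G (digit c)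
      digit-∈G false = 0∈G
      digit-∈G true  = 1∈G
      twist-∈G : ∀ c {t} → Translation∈G t → Translation∈G (twist c t)
      twist-∈G false t∈G = t∈G
      twist-∈G true  t∈G = neg-∈G t∈G

    translation-∈G : ∀ t → Translation∈G t
    translation-∈G t = subst (InG n) (affine-cong n refl (decode-encode n t)) (decode-∈G (encode n t))

  unit-∈G : ∀ n j → ∃[ d ] InG n (affine n (unit j) d)
  unit-∈G n 0F = 0#   , Translations.0∈G n
  unit-∈G n 1F = - 1# , subst (InG n) (a₂≡affine n) (g-gen 1F)
  unit-∈G n 2F = 1#   , subst (InG n) (a₁≡affine n) (g-gen 0F)
  unit-∈G n 3F = - i  , subst (InG n) (a₂⁻¹≡affine n) (g-inv (g-gen 1F))

  affine-∈G : ∀ n j d → InG n (affine n (unit j) d)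
  affine-∈G n j d with unit-∈G n j
  ... | d₀ , u∈G = subst (InG n) compose (g-mul u∈G (Translations.translation-∈G n (d + - d₀)))
    where
    compose : mul n (affine n (unit j) d₀) (affine n 1# (d + - d₀)) ≡ affine n (unit j) d
    compose = trans (affine-mul n (unit-odd j) refl d₀ (d + - d₀)) (cong₂ (affine n) (u*1 (unit j)) (translate d₀ d))
      where
      u*1 : ∀ u → u * 1# ≡ u
      u*1 = solve-∀ ℤ[i]-ring
      translate : ∀ d₀ d → 1# * d₀ + (d + - d₀) ≡ d
      translate = solve-∀ ℤ[i]-ring

  InG⇒affine : ∀ {n x} → InG n x → ∃[ j ] ∃[ d ] x ≡ affine n (unit j) d
  InG⇒affine {n} (g-gen 0F) = 2F , 1#     , a₁≡affine n
  InG⇒affine {n} (g-gen 1F) = 1F , - 1#   , a₂≡affine n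
  InG⇒affine {n} (g-gen 2F) = 1F , 1# + i , a₃≡affine n
  InG⇒affine {n} g-e        = 0F , 0#     , sym (affine-identity n)
  InG⇒affine {n} (g-mul x∈G y∈G) with InG⇒affine x∈G | InG⇒affine y∈G
  ... | j , d , refl | k , d′ , refl with unit-*-closed j k
  ...   | l , jk≡l = l , unit k * d + d′ ,
                     trans (affine-mul n (unit-odd j) (unit-odd k) d d′) (cong (λ u → affine n u (unit k * d + d′)) jk≡l)
  InG⇒affine {n} (g-inv x∈G) with InG⇒affine x∈G
  ... | j , d , refl with unit-inverse j
  ...   | k , jk≡1 = k , - (unit k * d) , affine-inv n (unit-odd j) (unit-odd k) jk≡1 d

module Enumeration where

  open import Data.Bool using (true; false)
  open import Data.Fin using (Fin)
  open import Data.List using (List; []; _∷_; map; _++_; length; cartesianProductWith; allFin)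
  open import Data.List.Properties using (length-++; length-map)
  open import Data.List.Membership.Propositional using (_∈_)
  open import Data.List.Membership.Propositional.Properties
    using (∈-cartesianProductWith⁺; ∈-cartesianProductWith⁻; ∈-allFin)
  open import Data.List.Relation.Unary.All using ([]; _∷_)
  open import Data.List.Relation.Unary.AllPairs using ([]; _∷_)
  open import Data.List.Relation.Unary.Any using (here; there)
  open import Data.List.Relation.Unary.Unique.Propositional using (Unique)
  open import Data.List.Relation.Unary.Unique.Propositional.Properties using (cartesianProductWith⁺; allFin⁺)
  open import Data.Nat using (ℕ; zero; suc; _*_; _+_; _^_; _≤_)
  open import Data.Nat.Properties using (^-distribˡ-+-*; *-comm)
  open import Data.Product using (_×_; _,_)
  open import Data.Vec as Vec using ()
  open import Data.Vec.Properties using (∷-injective)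
  open import Function.Bundles using (_⇔_; mk⇔)
  open import Relation.Binary.PropositionalEquality
  open ≡-Reasoning
  open PiAdicWords
  open AffineAutomorphisms
  open AffineModel

  length-cartesianProductWith : ∀ {A B C : Set} (f : A → B → C) xs ys →
                                length (cartesianProductWith f xs ys) ≡ length xs * length ys
  length-cartesianProductWith f []       ys = refl
  length-cartesianProductWith f (x ∷ xs) ys = begin
    length (map (f x) ys ++ cartesianProductWith f xs ys)
      ≡⟨ length-++ (map (f x) ys) ⟩
    length (map (f x) ys) + length (cartesianProductWith f xs ys)
      ≡⟨ cong₂ _+_ (length-map (f x) ys) (length-cartesianProductWith f xs ys) ⟩
    length ys + length xs * length ys
      ∎

  words : ∀ n → List (Word n)
  words zero    = Vec.[] ∷ []
  words (suc n) = cartesianProductWith Vec._∷_ (false ∷ true ∷ []) (words n)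

  ∈-words : ∀ {n} (w : Word n) → w ∈ words n
  ∈-words Vec.[]      = here refl
  ∈-words (c Vec.∷ w) = ∈-cartesianProductWith⁺ Vec._∷_ (∈-bits c) (∈-words w)
    where
    ∈-bits : ∀ c → c ∈ false ∷ true ∷ []
    ∈-bits false = here refl
    ∈-bits true  = there (here refl)

  words-unique : ∀ n → Unique (words n)
  words-unique zero    = [] ∷ []
  words-unique (suc n) = cartesianProductWith⁺ Vec._∷_ ∷-injective (((λ ()) ∷ []) ∷ [] ∷ []) (words-unique n)

  length-words : ∀ n → length (words n) ≡ 2 ^ n
  length-words zero    = refl
  length-words (suc n) =
    trans (length-cartesianProductWith Vec._∷_ (false ∷ true ∷ []) (words n)) (cong (2 *_) (length-words n))

  element : ∀ n → Fin 4 → Word n → Aut n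
  element n j w = affine n (unit j) (decode w)

  elements : ∀ n → List (Aut n)
  elements n = cartesianProductWith (element n) (allFin 4) (words n)

  elements-unique : ∀ n → 3 ≤ n → Unique (elements n)
  elements-unique n 3≤n = cartesianProductWith⁺ (element n) injective (allFin⁺ 4) (words-unique n)
    where
    injective : ∀ {j k w w′} → element n j w ≡ element n k w′ → j ≡ k × w ≡ w′
    injective {j} {k} {w} {w′} eq with affine-injective n (unit-odd j) (unit-odd k) eq
    ... | u≡u′ , d≡d′ =
      unit-injective-mod-π³ j k (encode-≤ 3≤n (≡-mod⇒encode-≡ n u≡u′)) ,
      trans (sym (encode-decode w)) (trans (≡-mod⇒encode-≡ n d≡d′) (encode-decode w′))

  InG⇔∈elements : ∀ n x → InG n x ⇔ x ∈ elements n
  InG⇔∈elements n x = mk⇔ to from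
    where
    to : InG n x → x ∈ elements n
    to x∈G with InG⇒affine x∈G
    ... | j , d , refl = subst (_∈ elements n) (affine-cong n (unit-odd j) (decode-encode n d))
                           (∈-cartesianProductWith⁺ (element n) (∈-allFin j) (∈-words (encode n d)))
    from : x ∈ elements n → InG n x
    from x∈ with ∈-cartesianProductWith⁻ (element n) (allFin 4) (words n) x∈
    ... | j , w , _ , _ , refl = affine-∈G n j (decode w)

  length-elements : ∀ n → length (elements n) ≡ 2 ^ (n + 2)
  length-elements n = begin
    length (elements n)   ≡⟨ length-cartesianProductWith (element n) (allFin 4) (words n) ⟩
    4 * length (words n)  ≡⟨ cong (4 *_) (length-words n) ⟩
    4 * 2 ^ n             ≡⟨ *-comm 4 (2 ^ n) ⟩
    2 ^ n * 2 ^ 2         ≡⟨ ^-distribˡ-+-* 2 n 2 ⟨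
    2 ^ (n + 2)           ∎

open import Data.Nat using (ℕ; _≤_; _^_; _+_)
open import Data.List using (List; length)
open import Data.List.Relation.Unary.Unique.Propositional using (Unique)
open import Data.List.Membership.Propositional using (_∈_)
open import Data.Product using (Σ; _×_; _,_)
open import Function.Bundles using (_⇔_)
open import Relation.Binary.PropositionalEquality using (_≡_)
open Enumeration using (elements; elements-unique; InG⇔∈elements; length-elements)

proposition3p9 : (n : ℕ) → 3 ≤ n →
    Σ (List (Aut n)) (λ xs →
      Unique xs × ((x : Aut n) → (InG n x ⇔ x ∈ xs)) × length xs ≡ 2 ^ (n + 2))
proposition3p9 n 3≤n = elements n , elements-unique n 3≤n , InG⇔∈elements n , length-elements n
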